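{- Let $n \ge 3$ and let $S$ be the set of all transpositions in $S_n$. Then \[ \mathrm{Aut}(\mathrm{Cay}(S_n,S)) \supseteq (R(S_n) \rtimes \mathrm{Inn}(S_n)) \rtimes \mathbb{Z}_2, \] where $\mathbb{Z}_2 = \langle h \rangle$ and $h$ is the map $\alpha \mapsto \alpha^{ -1}$.
   Context: For a group $H$ and a subset $S \subseteq H$ with $1 \notin S$ and $S = S^{ -1}$, the Cayley graph $\mathrm{Cay}(H,S)$ is the simple undirected graph with vertex set $H$ and edges $\{h, sh\}$ for $h \in H$, $s \in S$. $R(S_n)$ is the right regular representation of $S_n$ (maps $x \mapsto xg$), and $\mathrm{Inn}(S_n)$ is the group of inner automorphisms of $S_n$, both viewed as permutations of the vertex set $S_n$. -}

module Defs where

open import Data.Nat using (ℕ)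
open import Data.Fin using (Fin)
open import Data.Bool using (Bool; true; false)
open import Data.Product using (Σ; ∃; ∃-syntax; _×_)
open import Relation.Binary.PropositionalEquality using (_≢_)
open import Data.Fin.Permutation as P using (Permutation′; _⟨$⟩ʳ_; _∘ₚ_; flip; transpose)

Sym : ℕ → Set
Sym n = Permutation′ n

_≈_ : ∀ {n} → Sym n → Sym n → Set
_≈_ = P._≈_

-- Group product in the usual (right-to-left) convention: (σ · τ) i = σ (τ i).
_·_ : ∀ {n} → Sym n → Sym n → Sym n
σ · τ = τ ∘ₚ σ

_⁻¹ : ∀ {n} → Sym n → Sym n
σ ⁻¹ = flip σ

IsTransposition : ∀ {n} → Sym n → Set
IsTransposition {n} s = Σ (Fin n) λ i → Σ (Fin n) λ j → (i ≢ j) × (s ≈ transpose i j)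

Adj : ∀ {n} → Sym n → Sym n → Set
Adj x y = ∃[ s ] (IsTransposition s × (y ≈ (s · x)))

IsCayAut : ∀ {n} → (Sym n → Sym n) → Set
IsCayAut {n} φ =
  (∀ x y → x ≈ y → φ x ≈ φ y) ×
  (∀ x y → φ x ≈ φ y → x ≈ y) ×
  (∀ y → ∃[ x ] (φ x ≈ y)) ×
  (∀ x y → (Adj x y → Adj (φ x) (φ y)) × (Adj (φ x) (φ y) → Adj x y))

R : ∀ {n} → Sym n → Sym n → Sym n
R k x = x · k

Inn : ∀ {n} → Sym n → Sym n → Sym n
Inn g x = ((g ⁻¹) · x) · g

hPow : ∀ {n} → Bool → Sym n → Sym n
hPow false x = x
hPow true  x = x ⁻¹

-- A general element of (R(S_n) ⋊ Inn(S_n)) ⋊ Z₂ as a permutation of S_n.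
element : ∀ {n} → Sym n → Sym n → Bool → Sym n → Sym n
element k g b x = hPow b (Inn g (R k x))

-- The element (k, g, b) acts as hPow b ∘ Inn g ∘ R k, so it suffices that
-- each factor is a graph automorphism.  Conjugates and inverses of
-- transpositions are transpositions, hence right translations
-- (y = s x ⇒ y k = s (x k)), inner automorphisms
-- (y = s x ⇒ g⁻¹ y g = (g⁻¹ s g)(g⁻¹ x g)) and inversion
-- (y = s x ⇒ y⁻¹ = (x⁻¹ s⁻¹ x) x⁻¹) preserve adjacency; each has an inverse
-- of the same kind, so it also reflects adjacency.  The bound n ≥ 3 is only
-- needed for the reverse inclusion and is unused.
module Submission where

open import Defs
open import Data.Nat using (ℕ; _≤_)
open import Data.Bool using (Bool; true; false)
open import Data.Fin using (Fin; _≟_)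
open import Data.Fin.Permutation using (_⟨$⟩ʳ_; _⟨$⟩ˡ_; transpose; inverseˡ; inverseʳ)
import Data.Fin.Permutation.Components as PC
open import Data.Product using (_,_; proj₁; proj₂)
open import Function using (_∘_; id)
open import Function.Definitions using (Injective)
open import Relation.Nullary using (Dec; yes; no)
open import Relation.Nullary.Negation using (contradiction)
open import Relation.Binary.PropositionalEquality

private
  variable
    n : ℕ

Congruent : (Sym n → Sym n) → Set
Congruent φ = ∀ x y → x ≈ y → φ x ≈ φ y

PreservesAdj : (Sym n → Sym n) → Set
PreservesAdj φ = ∀ x y → Adj x y → Adj (φ x) (φ y)

⁻¹-cong : Congruent {n} _⁻¹
⁻¹-cong x y x≈y i = begin
  x ⟨$⟩ˡ i                         ≡⟨ inverseˡ y ⟨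
  y ⟨$⟩ˡ (y ⟨$⟩ʳ (x ⟨$⟩ˡ i))       ≡⟨ cong (y ⟨$⟩ˡ_) (x≈y (x ⟨$⟩ˡ i)) ⟨
  y ⟨$⟩ˡ (x ⟨$⟩ʳ (x ⟨$⟩ˡ i))       ≡⟨ cong (y ⟨$⟩ˡ_) (inverseʳ x) ⟩
  y ⟨$⟩ˡ i                         ∎
  where open ≡-Reasoning

⟨$⟩ˡ-injective : (g : Sym n) → Injective _≡_ _≡_ (g ⟨$⟩ˡ_)
⟨$⟩ˡ-injective g {i} {j} eq = begin
  i                        ≡⟨ inverseʳ g ⟨
  g ⟨$⟩ʳ (g ⟨$⟩ˡ i)        ≡⟨ cong (g ⟨$⟩ʳ_) eq ⟩
  g ⟨$⟩ʳ (g ⟨$⟩ˡ j)        ≡⟨ inverseʳ g ⟩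
  j                        ∎
  where open ≡-Reasoning

transpose-at-i : (i j : Fin n) → PC.transpose i j i ≡ j
transpose-at-i i j with i ≟ i
... | yes _   = refl
... | no i≢i  = contradiction refl i≢i

transpose-at-j : (i j : Fin n) → PC.transpose i j j ≡ i
transpose-at-j i j with j ≟ i
... | yes j≡i = j≡i
... | no _ with j ≟ j
...   | yes _   = refl
...   | no j≢j  = contradiction refl j≢j

transpose-fixes : (i j k : Fin n) → k ≢ i → k ≢ j → PC.transpose i j k ≡ k
transpose-fixes i j k k≢i k≢j with k ≟ i
... | yes k≡i = contradiction k≡i k≢i
... | no _ with k ≟ j
...   | yes k≡j = contradiction k≡j k≢j
...   | no _    = refl

transpose-natural : (f : Fin n → Fin n) → Injective _≡_ _≡_ f →
                    (i j k : Fin n) →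
                    f (PC.transpose i j k) ≡ PC.transpose (f i) (f j) (f k)
transpose-natural f f-inj i j k = by-cases (k ≟ i) (k ≟ j)
  where
  open ≡-Reasoning
  by-cases : Dec (k ≡ i) → Dec (k ≡ j) →
             f (PC.transpose i j k) ≡ PC.transpose (f i) (f j) (f k)
  by-cases (yes refl) _ = begin
    f (PC.transpose k j k)           ≡⟨ cong f (transpose-at-i k j) ⟩
    f j                              ≡⟨ transpose-at-i (f k) (f j) ⟨
    PC.transpose (f k) (f j) (f k)   ∎
  by-cases (no _) (yes refl) = begin
    f (PC.transpose i k k)           ≡⟨ cong f (transpose-at-j i k) ⟩
    f i                              ≡⟨ transpose-at-j (f i) (f k) ⟨
    PC.transpose (f i) (f k) (f k)   ∎
  by-cases (no k≢i) (no k≢j) = begin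
    f (PC.transpose i j k)           ≡⟨ cong f (transpose-fixes i j k k≢i k≢j) ⟩
    f k                              ≡⟨ transpose-fixes (f i) (f j) (f k)
                                          (λ fk≡fi → k≢i (f-inj fk≡fi))
                                          (λ fk≡fj → k≢j (f-inj fk≡fj)) ⟨
    PC.transpose (f i) (f j) (f k)   ∎

Inn-transpose : (g : Sym n) (i j : Fin n) →
                Inn g (transpose i j) ≈ transpose (g ⟨$⟩ˡ i) (g ⟨$⟩ˡ j)
Inn-transpose g i j k = begin
  g ⟨$⟩ˡ PC.transpose i j (g ⟨$⟩ʳ k)                              ≡⟨ transpose-natural (g ⟨$⟩ˡ_) (⟨$⟩ˡ-injective g) i j _ ⟩
  PC.transpose (g ⟨$⟩ˡ i) (g ⟨$⟩ˡ j) (g ⟨$⟩ˡ (g ⟨$⟩ʳ k))          ≡⟨ cong (PC.transpose _ _) (inverseˡ g) ⟩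
  PC.transpose (g ⟨$⟩ˡ i) (g ⟨$⟩ˡ j) k                            ∎
  where open ≡-Reasoning

Inn-cong : (g : Sym n) → Congruent (Inn g)
Inn-cong g x y x≈y k = cong (g ⟨$⟩ˡ_) (x≈y (g ⟨$⟩ʳ k))

IsTransposition-Inn : (g s : Sym n) → IsTransposition s →
                      IsTransposition (Inn g s)
IsTransposition-Inn g s (i , j , i≢j , s≈tij) =
  g ⟨$⟩ˡ i , g ⟨$⟩ˡ j , (λ gi≡gj → i≢j (⟨$⟩ˡ-injective g gi≡gj)) ,
  λ k → trans (Inn-cong g s (transpose i j) s≈tij k) (Inn-transpose g i j k)

IsTransposition-⁻¹ : (s : Sym n) → IsTransposition s → IsTransposition (s ⁻¹)
IsTransposition-⁻¹ s (i , j , i≢j , s≈tij) =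
  j , i , (λ j≡i → i≢j (sym j≡i)) , ⁻¹-cong s (transpose i j) s≈tij

Adj-resp : (x x′ y y′ : Sym n) → x ≈ x′ → y ≈ y′ → Adj x y → Adj x′ y′
Adj-resp x x′ y y′ x≈x′ y≈y′ (s , s∈S , y≈sx) =
  s , s∈S , λ k → trans (sym (y≈y′ k)) (trans (y≈sx k) (cong (s ⟨$⟩ʳ_) (x≈x′ k)))

IsCayAut-inverses : (φ ψ : Sym n → Sym n) →
                    Congruent φ → Congruent ψ →
                    (∀ x → ψ (φ x) ≈ x) → (∀ y → φ (ψ y) ≈ y) →
                    PreservesAdj φ → PreservesAdj ψ → IsCayAut φ
IsCayAut-inverses φ ψ φ-cong ψ-cong ψφ≈id φψ≈id φ-adj ψ-adj =
  φ-cong ,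
  (λ x y φx≈φy k → begin
     x ⟨$⟩ʳ k          ≡⟨ ψφ≈id x k ⟨
     ψ (φ x) ⟨$⟩ʳ k    ≡⟨ ψ-cong _ _ φx≈φy k ⟩
     ψ (φ y) ⟨$⟩ʳ k    ≡⟨ ψφ≈id y k ⟩
     y ⟨$⟩ʳ k          ∎) ,
  (λ y → ψ y , φψ≈id y) ,
  λ x y → φ-adj x y ,
          λ x~y → Adj-resp (ψ (φ x)) x (ψ (φ y)) y (ψφ≈id x) (ψφ≈id y) (ψ-adj _ _ x~y)
  where open ≡-Reasoning

IsCayAut-∘ : (φ ψ : Sym n → Sym n) → IsCayAut φ → IsCayAut ψ → IsCayAut (φ ∘ ψ)
IsCayAut-∘ φ ψ (φ-cong , φ-inj , φ-surj , φ-adj) (ψ-cong , ψ-inj , ψ-surj , ψ-adj) =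
  (λ x y → φ-cong _ _ ∘ ψ-cong x y) ,
  (λ x y → ψ-inj x y ∘ φ-inj _ _) ,
  (λ z → let (y , φy≈z) = φ-surj z ; (x , ψx≈y) = ψ-surj y
         in x , λ k → trans (φ-cong _ _ ψx≈y k) (φy≈z k)) ,
  λ x y → (proj₁ (φ-adj _ _) ∘ proj₁ (ψ-adj x y)) ,
          (proj₂ (ψ-adj x y) ∘ proj₂ (φ-adj _ _))

R-cong : (k : Sym n) → Congruent (R k)
R-cong k x y x≈y i = x≈y (k ⟨$⟩ʳ i)

R-preservesAdj : (k : Sym n) → PreservesAdj (R k)
R-preservesAdj k x y (s , s∈S , y≈sx) = s , s∈S , λ i → y≈sx (k ⟨$⟩ʳ i)

R-isCayAut : (k : Sym n) → IsCayAut (R k)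
R-isCayAut k =
  IsCayAut-inverses (R k) (R (k ⁻¹)) (R-cong k) (R-cong (k ⁻¹))
    (λ x i → cong (x ⟨$⟩ʳ_) (inverseʳ k)) (λ y i → cong (y ⟨$⟩ʳ_) (inverseˡ k))
    (R-preservesAdj k) (R-preservesAdj (k ⁻¹))

Inn-preservesAdj : (g : Sym n) → PreservesAdj (Inn g)
Inn-preservesAdj g x y (s , s∈S , y≈sx) =
  Inn g s , IsTransposition-Inn g s s∈S ,
  λ i → cong (g ⟨$⟩ˡ_) (trans (y≈sx (g ⟨$⟩ʳ i)) (cong (s ⟨$⟩ʳ_) (sym (inverseʳ g))))

Inn-isCayAut : (g : Sym n) → IsCayAut (Inn g)
Inn-isCayAut g =
  IsCayAut-inverses (Inn g) (Inn (g ⁻¹)) (Inn-cong g) (Inn-cong (g ⁻¹))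
    (λ x i → trans (inverseʳ g) (cong (x ⟨$⟩ʳ_) (inverseʳ g)))
    (λ y i → trans (inverseˡ g) (cong (y ⟨$⟩ʳ_) (inverseˡ g)))
    (Inn-preservesAdj g) (Inn-preservesAdj (g ⁻¹))

⁻¹-preservesAdj : PreservesAdj {n} _⁻¹
⁻¹-preservesAdj x y (s , s∈S , y≈sx) =
  Inn x (s ⁻¹) , IsTransposition-Inn x (s ⁻¹) (IsTransposition-⁻¹ s s∈S) ,
  λ i → trans (⁻¹-cong y (s · x) y≈sx i) (cong (λ j → x ⟨$⟩ˡ (s ⟨$⟩ˡ j)) (sym (inverseʳ x)))

hPow-isCayAut : (b : Bool) → IsCayAut {n} (hPow b)
hPow-isCayAut false = (λ _ _ → id) , (λ _ _ → id) , (λ y → y , λ _ → refl) , λ _ _ → id , id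
hPow-isCayAut true  =
  IsCayAut-inverses _⁻¹ _⁻¹ ⁻¹-cong ⁻¹-cong (λ _ _ → refl) (λ _ _ → refl)
    ⁻¹-preservesAdj ⁻¹-preservesAdj

mainTheorem8 : (n : ℕ) → 3 ≤ n → (k g : Sym n) (b : Bool) →
    IsCayAut (element k g b)
mainTheorem8 _ _ k g b =
  IsCayAut-∘ (hPow b) (Inn g ∘ R k) (hPow-isCayAut b)
    (IsCayAut-∘ (Inn g) (R k) (Inn-isCayAut g) (R-isCayAut k))
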